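{- Let $G$ be a finite group with identity $e$, and let $S,T,U\subseteq G\setminus\{e\}$ be symmetric subsets. Then the following are equivalent: (1) $A(G;U)=A(G;S)\,A(G;T)$; (2) $U=ST$, and for every $u\in U$ there exists a unique pair $(s,t)\in S\times T$ with $u=st$; (3) $\bigl(\sum_{s\in S}s\bigr)\bigl(\sum_{t\in T}t\bigr)=\sum_{u\in U}u$ in the group ring $\mathbb{Z}[G]$.
   Context: A subset $X$ of a group is symmetric if $X^{ -1}=X$. Fix an enumeration $G=\{g_1,\dots,g_n\}$. For $X\subseteq G$, the (Cayley) adjacency matrix is $A(G;X)=(a_{ij})_{1\le i,j\le n}$ with $a_{ij}=1$ if $g_i^{ -1}g_j\in X$ and $a_{ij}=0$ otherwise. $ST=\{st: s\in S,\ t\in T\}$. -}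

module Defs where

open import Data.Nat using (ℕ)
open import Data.Fin using (Fin; zero; suc)
open import Data.Fin.Subset using (Subset; _∈_; _∉_)
open import Data.Fin.Subset.Properties using (_∈?_)
open import Data.Integer using (ℤ; _+_; _*_; 0ℤ; 1ℤ)
open import Data.Product using (Σ; ∃; ∃!; _×_; _,_)
open import Relation.Nullary using (yes; no)
open import Relation.Binary.PropositionalEquality using (_≡_)
open import Algebra.Structures using (IsGroup)
open import Function.Bundles using (_⇔_)

-- A finite group of order n, with carrier Fin n.  The enumeration
-- G = {g_1,...,g_n} of the paper is g_i = i.
record FinGroup (n : ℕ) : Set where
  field
    _∙_      : Fin n → Fin n → Fin n
    e        : Fin n
    _⁻¹      : Fin n → Fin n
    isGroup  : IsGroup _≡_ _∙_ e _⁻¹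
  infixl 7 _∙_
  infix 8 _⁻¹

module _ {n : ℕ} (G : FinGroup n) where
  open FinGroup G

  Symmetric : Subset n → Set
  Symmetric X = ∀ y → (Σ (Fin n) λ x → x ∈ X × y ≡ x ⁻¹) ⇔ (y ∈ X)

  _∈Prod_,_ : Fin n → Subset n → Subset n → Set
  u ∈Prod S , T = Σ (Fin n) λ s → Σ (Fin n) λ t → s ∈ S × t ∈ T × u ≡ s ∙ t

  𝟙 : Subset n → Fin n → ℤ
  𝟙 X x with x ∈? X
  ... | yes _ = 1ℤ
  ... | no  _ = 0ℤ

Σℤ : (n : ℕ) → (Fin n → ℤ) → ℤ
Σℤ ℕ.zero f = 0ℤ
Σℤ (ℕ.suc n) f = f zero + Σℤ n (λ i → f (suc i))

Matrix : ℕ → Set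
Matrix n = Fin n → Fin n → ℤ

_⊗_ : {n : ℕ} → Matrix n → Matrix n → Matrix n
_⊗_ {n} A B i j = Σℤ n (λ k → A i k * B k j)

module _ {n : ℕ} (G : FinGroup n) where
  open FinGroup G

  Adj : Subset n → Matrix n
  Adj X i j = 𝟙 G X (i ⁻¹ ∙ j)

  ZG : Set
  ZG = Fin n → ℤ

  _⋆_ : ZG → ZG → ZG
  (f ⋆ g) x = Σℤ n (λ y → f y * g (y ⁻¹ ∙ x))

  sumOf : Subset n → ZG
  sumOf X = 𝟙 G X

{-# OPTIONS --safe #-}
-- Both (1) and (3) say that the convolution 1_S ⋆ 1_T equals 1_U: the matrix
-- A(G;S) A(G;T) has (i,j) entry (1_S ⋆ 1_T)(g_i⁻¹ g_j), by translating the summation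
-- index by g_i.  The value (1_S ⋆ 1_T)(x) is the number of s ∈ S with s⁻¹x ∈ T,
-- i.e. of factorisations x = st with s ∈ S, t ∈ T; it equals 1_U(x) for every x
-- exactly when every element of U has exactly one factorisation and no element
-- outside U has one, which is (2).
module Submission where

open import Defs
open import Data.Nat using (ℕ)
open import Data.Fin using (Fin)
open import Data.Fin.Subset using (Subset; _∈_; _∉_)
open import Data.Product using (Σ; ∃!; _×_; _,_; proj₁; proj₂)
open import Relation.Binary.PropositionalEquality using (_≡_)
open import Function.Bundles using (_⇔_)

open import Data.Nat as ℕ using (zero; suc)
import Data.Nat.Properties as ℕ
open import Data.Fin using (zero; suc)
import Data.Fin.Properties as Fin
open import Data.Fin.Subset.Properties using (_∈?_)
open import Data.Fin.Permutation using (Permutation′; permutation; _⟨$⟩ʳ_)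
open import Data.Integer using (ℤ; +_; _+_; _*_; 0ℤ; 1ℤ)
import Data.Integer.Properties as ℤ
open import Data.Product using (∃; ∃-syntax; ∄)
open import Data.Sum using (_⊎_; inj₁; inj₂)
open import Data.Empty using (⊥-elim)
open import Function using (_∘_; case_of_; mk⇔)
open import Function.Bundles using (Equivalence)
open import Function.Construct.Composition using (_⇔-∘_)
open import Relation.Nullary using (¬_; yes; no)
open import Relation.Binary.PropositionalEquality
  using (refl; sym; trans; cong; cong₂; subst; module ≡-Reasoning)
open import Algebra.Bundles using (Group)
open import Algebra.Structures using (IsGroup)
import Algebra.Properties.Group as GroupProperties
import Algebra.Properties.CommutativeMonoid.Sum as CommutativeMonoidSum

module ℤSum = CommutativeMonoidSum ℤ.+-0-commutativeMonoid

Σℤ-cong : ∀ n {f g : Fin n → ℤ} → (∀ i → f i ≡ g i) → Σℤ n f ≡ Σℤ n g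
Σℤ-cong zero    f≗g = refl
Σℤ-cong (suc n) f≗g = cong₂ _+_ (f≗g zero) (Σℤ-cong n (f≗g ∘ suc))

Σℤ≡sum : ∀ n (f : Fin n → ℤ) → Σℤ n f ≡ ℤSum.sum f
Σℤ≡sum zero    f = refl
Σℤ≡sum (suc n) f = cong (λ r → f zero + r) (Σℤ≡sum n (f ∘ suc))

Σℤ-permute : ∀ n (f : Fin n → ℤ) (π : Permutation′ n) → Σℤ n f ≡ Σℤ n (f ∘ (π ⟨$⟩ʳ_))
Σℤ-permute n f π = begin
  Σℤ n f                     ≡⟨ Σℤ≡sum n f ⟩
  ℤSum.sum f                 ≡⟨ ℤSum.sum-permute f π ⟩
  ℤSum.sum (f ∘ (π ⟨$⟩ʳ_))   ≡⟨ sym (Σℤ≡sum n (f ∘ (π ⟨$⟩ʳ_))) ⟩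
  Σℤ n (f ∘ (π ⟨$⟩ʳ_))       ∎
  where open ≡-Reasoning

private
  variable
    n : ℕ
    f : Fin n → ℤ
    P : Fin n → Set

IsIndicatorOf : ∀ {n} → (Fin n → ℤ) → (Fin n → Set) → Set
IsIndicatorOf f P = ∀ y → (P y × f y ≡ 1ℤ) ⊎ (¬ P y × f y ≡ 0ℤ)

*-isIndicatorOf-× : ∀ {n} {f g : Fin n → ℤ} {P Q : Fin n → Set}
  → IsIndicatorOf f P → IsIndicatorOf g Q
  → IsIndicatorOf (λ y → f y * g y) (λ y → P y × Q y)
*-isIndicatorOf-× {g = g} indf indg y with indf y | indg y
... | inj₁ (p , fy≡1) | inj₁ (q , gy≡1) = inj₁ ((p , q) , cong₂ _*_ fy≡1 gy≡1)
... | inj₁ (_ , fy≡1) | inj₂ (¬q , gy≡0) = inj₂ (¬q ∘ proj₂ , cong₂ _*_ fy≡1 gy≡0)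
... | inj₂ (¬p , fy≡0) | _ = inj₂ (¬p ∘ proj₁ , trans (cong (_* g y) fy≡0) (ℤ.*-zeroˡ (g y)))

Σℤ-indicator-nonneg : IsIndicatorOf f P → ∃[ k ] Σℤ n f ≡ + k
Σℤ-indicator-nonneg {zero}  ind = 0 , refl
Σℤ-indicator-nonneg {suc n} ind with Σℤ-indicator-nonneg (ind ∘ suc) | ind zero
... | k , rest≡k | inj₁ (_ , f0≡1) = suc k , cong₂ _+_ f0≡1 rest≡k
... | k , rest≡k | inj₂ (_ , f0≡0) = k , cong₂ _+_ f0≡0 rest≡k

Σℤ-indicator-∄⇒≡0 : IsIndicatorOf f P → ∄ P → Σℤ n f ≡ 0ℤ
Σℤ-indicator-∄⇒≡0 {zero}  ind ∄P = refl
Σℤ-indicator-∄⇒≡0 {suc n} ind ∄P with ind zero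
... | inj₁ (p , _)    = ⊥-elim (∄P (zero , p))
... | inj₂ (_ , f0≡0) = cong₂ _+_ f0≡0 (Σℤ-indicator-∄⇒≡0 (ind ∘ suc) (∄P ∘ λ (y , p) → suc y , p))

Σℤ-indicator-≡0⇒∄ : IsIndicatorOf f P → Σℤ n f ≡ 0ℤ → ∄ P
Σℤ-indicator-≡0⇒∄ {suc n} {f} ind Σ≡0 (y , p) with ind zero
... | inj₁ (_ , f0≡1) =
  let k , rest≡k = Σℤ-indicator-nonneg (ind ∘ suc) in
  case trans (sym Σ≡0) (cong₂ _+_ f0≡1 rest≡k) of λ ()
... | inj₂ (¬p0 , f0≡0) with y
...   | zero   = ¬p0 p
...   | suc y′ = Σℤ-indicator-≡0⇒∄ (ind ∘ suc) rest≡0 (y′ , p)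
  where
    rest≡0 : Σℤ n (f ∘ suc) ≡ 0ℤ
    rest≡0 = trans (sym (ℤ.+-identityˡ _)) (trans (cong (_+ Σℤ n (f ∘ suc)) (sym f0≡0)) Σ≡0)

Σℤ-indicator-∃!⇒≡1 : IsIndicatorOf f P → ∃! _≡_ P → Σℤ n f ≡ 1ℤ
Σℤ-indicator-∃!⇒≡1 {suc n} ind (zero , p , unique) with ind zero
... | inj₁ (_ , f0≡1) = cong₂ _+_ f0≡1 (Σℤ-indicator-∄⇒≡0 (ind ∘ suc) λ (y , q) → Fin.0≢1+n (unique q))
... | inj₂ (¬p , _)   = ⊥-elim (¬p p)
Σℤ-indicator-∃!⇒≡1 {suc n} ind (suc y , p , unique) with ind zero
... | inj₁ (p0 , _)   = ⊥-elim (Fin.0≢1+n (sym (unique p0)))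
... | inj₂ (_ , f0≡0) =
  trans (cong₂ _+_ f0≡0 (Σℤ-indicator-∃!⇒≡1 (ind ∘ suc) (y , p , Fin.suc-injective ∘ unique)))
        (ℤ.+-identityˡ 1ℤ)

Σℤ-indicator-≡1⇒∃! : IsIndicatorOf f P → Σℤ n f ≡ 1ℤ → ∃! _≡_ P
Σℤ-indicator-≡1⇒∃! {suc n} {f} {P} ind Σ≡1 with ind zero
... | inj₁ (p0 , f0≡1) = zero , p0 , unique
  where
    rest≡0 : Σℤ n (f ∘ suc) ≡ 0ℤ
    rest≡0 =
      let k , rest≡k = Σℤ-indicator-nonneg (ind ∘ suc)
          1+k≡1 = ℤ.+-injective (trans (sym (cong₂ _+_ f0≡1 rest≡k)) Σ≡1)
      in trans rest≡k (cong +_ (ℕ.suc-injective 1+k≡1))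
    unique : ∀ {y} → P y → zero ≡ y
    unique {zero}  _ = refl
    unique {suc y} p = ⊥-elim (Σℤ-indicator-≡0⇒∄ (ind ∘ suc) rest≡0 (y , p))
... | inj₂ (¬p0 , f0≡0) =
  let y , p , unique = Σℤ-indicator-≡1⇒∃! (ind ∘ suc) rest≡1 in
  suc y , p , λ { {zero} p0 → ⊥-elim (¬p0 p0) ; {suc y′} q → cong suc (unique q) }
  where
    rest≡1 : Σℤ n (f ∘ suc) ≡ 1ℤ
    rest≡1 = trans (sym (ℤ.+-identityˡ _)) (trans (cong (_+ Σℤ n (f ∘ suc)) (sym f0≡0)) Σ≡1)

module _ {n : ℕ} (G : FinGroup n) where
  open FinGroup G
  open IsGroup isGroup using (assoc; identityˡ)

  group : Group _ _
  group = record { isGroup = isGroup }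

  open GroupProperties group using (\\-leftDividesˡ; \\-leftDividesʳ; ε⁻¹≈ε; ⁻¹-anti-homo-∙)

  e⁻¹∙x≡x : ∀ x → e ⁻¹ ∙ x ≡ x
  e⁻¹∙x≡x x = trans (cong (_∙ x) ε⁻¹≈ε) (identityˡ x)

  x≡s∙t⇒s⁻¹∙x≡t : ∀ {x s t} → x ≡ s ∙ t → s ⁻¹ ∙ x ≡ t
  x≡s∙t⇒s⁻¹∙x≡t {s = s} {t} x≡st = trans (cong (s ⁻¹ ∙_) x≡st) (\\-leftDividesʳ s t)

  leftTranslation : Fin n → Permutation′ n
  leftTranslation g = permutation (g ∙_) (g ⁻¹ ∙_) (\\-leftDividesˡ g) (\\-leftDividesʳ g)

  𝟙-isIndicatorOf : ∀ X → IsIndicatorOf (𝟙 G X) (_∈ X)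
  𝟙-isIndicatorOf X x with x ∈? X
  ... | yes x∈X = inj₁ (x∈X , refl)
  ... | no  x∉X = inj₂ (x∉X , refl)

  𝟙-∈ : ∀ {X x} → x ∈ X → 𝟙 G X x ≡ 1ℤ
  𝟙-∈ {X} {x} x∈X with 𝟙-isIndicatorOf X x
  ... | inj₁ (_ , 𝟙≡1) = 𝟙≡1
  ... | inj₂ (x∉X , _) = ⊥-elim (x∉X x∈X)

  Adj-⊗ : ∀ S T i j → (Adj G S ⊗ Adj G T) i j ≡ _⋆_ G (sumOf G S) (sumOf G T) (i ⁻¹ ∙ j)
  Adj-⊗ S T i j = begin
    Σℤ n (λ k → 𝟙 G S (i ⁻¹ ∙ k) * 𝟙 G T (k ⁻¹ ∙ j))
      ≡⟨ Σℤ-permute n _ (leftTranslation i) ⟩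
    Σℤ n (λ y → 𝟙 G S (i ⁻¹ ∙ (i ∙ y)) * 𝟙 G T ((i ∙ y) ⁻¹ ∙ j))
      ≡⟨ Σℤ-cong n (λ y → cong₂ _*_ (cong (𝟙 G S) (\\-leftDividesʳ i y))
                                      (cong (𝟙 G T) (translate y))) ⟩
    Σℤ n (λ y → 𝟙 G S y * 𝟙 G T (y ⁻¹ ∙ (i ⁻¹ ∙ j)))
      ∎
    where
      open ≡-Reasoning
      translate : ∀ y → (i ∙ y) ⁻¹ ∙ j ≡ y ⁻¹ ∙ (i ⁻¹ ∙ j)
      translate y = trans (cong (_∙ j) (⁻¹-anti-homo-∙ i y)) (assoc _ _ _)

  Adj-⊗⇔⋆ : ∀ S T U
    → (∀ i j → Adj G U i j ≡ (Adj G S ⊗ Adj G T) i j)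
    ⇔ (∀ x → _⋆_ G (sumOf G S) (sumOf G T) x ≡ sumOf G U x)
  Adj-⊗⇔⋆ S T U = mk⇔ atIdentity (λ c i j → sym (trans (Adj-⊗ S T i j) (c (i ⁻¹ ∙ j))))
    where
      atIdentity : (∀ i j → Adj G U i j ≡ (Adj G S ⊗ Adj G T) i j)
                 → ∀ x → _⋆_ G (sumOf G S) (sumOf G T) x ≡ sumOf G U x
      atIdentity c x = begin
        _⋆_ G (sumOf G S) (sumOf G T) x           ≡⟨ cong (_⋆_ G (sumOf G S) (sumOf G T)) (e⁻¹∙x≡x x) ⟨
        _⋆_ G (sumOf G S) (sumOf G T) (e ⁻¹ ∙ x)  ≡⟨ Adj-⊗ S T e x ⟨
        (Adj G S ⊗ Adj G T) e x                   ≡⟨ c e x ⟨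
        𝟙 G U (e ⁻¹ ∙ x)                          ≡⟨ cong (𝟙 G U) (e⁻¹∙x≡x x) ⟩
        𝟙 G U x                                   ∎
        where open ≡-Reasoning

  module _ (S T : Subset n) where

    Factorisation : Fin n → Fin n × Fin n → Set
    Factorisation x p = proj₁ p ∈ S × proj₂ p ∈ T × x ≡ proj₁ p ∙ proj₂ p

    LeftFactor : Fin n → Fin n → Set
    LeftFactor x s = s ∈ S × s ⁻¹ ∙ x ∈ T

    factorisation-leftFactor : ∀ {x p} → Factorisation x p → LeftFactor x (proj₁ p)
    factorisation-leftFactor (s∈S , t∈T , x≡st) = s∈S , subst (_∈ T) (sym (x≡s∙t⇒s⁻¹∙x≡t x≡st)) t∈T

    leftFactor-factorisation : ∀ {x s} → LeftFactor x s → Factorisation x (s , s ⁻¹ ∙ x)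
    leftFactor-factorisation {x} {s} (s∈S , s⁻¹x∈T) = s∈S , s⁻¹x∈T , sym (\\-leftDividesˡ s x)

    ∈Prod⇔∃LeftFactor : ∀ x → _∈Prod_,_ G x S T ⇔ ∃ (LeftFactor x)
    ∈Prod⇔∃LeftFactor x = mk⇔
      (λ (s , t , fact) → s , factorisation-leftFactor fact)
      (λ (s , lf) → s , s ⁻¹ ∙ x , leftFactor-factorisation lf)

    ∃!Factorisation⇔∃!LeftFactor : ∀ x → ∃! _≡_ (Factorisation x) ⇔ ∃! _≡_ (LeftFactor x)
    ∃!Factorisation⇔∃!LeftFactor x = mk⇔
      (λ (p , fact , unique) → proj₁ p , factorisation-leftFactor fact ,
         λ lf → cong proj₁ (unique (leftFactor-factorisation lf)))
      (λ (s , lf , unique) → (s , s ⁻¹ ∙ x) , leftFactor-factorisation lf ,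
         λ { {s′ , t′} fact@(_ , _ , x≡s′t′) →
               let s≡s′ = unique (factorisation-leftFactor fact)
               in cong₂ _,_ s≡s′ (trans (cong (λ z → z ⁻¹ ∙ x) s≡s′) (x≡s∙t⇒s⁻¹∙x≡t x≡s′t′)) })

    ⋆-isIndicatorOf-LeftFactor : ∀ x
      → IsIndicatorOf (λ y → sumOf G S y * sumOf G T (y ⁻¹ ∙ x)) (LeftFactor x)
    ⋆-isIndicatorOf-LeftFactor x =
      *-isIndicatorOf-× (𝟙-isIndicatorOf S) (𝟙-isIndicatorOf T ∘ (λ y → y ⁻¹ ∙ x))

    ⋆⇔uniqueFactorisation : ∀ U
      → (∀ x → _⋆_ G (sumOf G S) (sumOf G T) x ≡ sumOf G U x)
      ⇔ ((∀ x → (x ∈ U) ⇔ _∈Prod_,_ G x S T) × (∀ u → u ∈ U → ∃! _≡_ (Factorisation u)))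
    ⋆⇔uniqueFactorisation U = mk⇔ toFactorisations fromFactorisations
      where
        open Equivalence using (to; from)

        toFactorisations : (∀ x → _⋆_ G (sumOf G S) (sumOf G T) x ≡ sumOf G U x)
          → (∀ x → (x ∈ U) ⇔ _∈Prod_,_ G x S T) × (∀ u → u ∈ U → ∃! _≡_ (Factorisation u))
        toFactorisations ⋆≡𝟙 = (λ x → mk⇔ (∈U⇒∈Prod x) (∈Prod⇒∈U x)) , ∃!Factorisation
          where
            ∃!LeftFactor : ∀ u → u ∈ U → ∃! _≡_ (LeftFactor u)
            ∃!LeftFactor u u∈U =
              Σℤ-indicator-≡1⇒∃! (⋆-isIndicatorOf-LeftFactor u) (trans (⋆≡𝟙 u) (𝟙-∈ u∈U))

            ∃!Factorisation : ∀ u → u ∈ U → ∃! _≡_ (Factorisation u)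
            ∃!Factorisation u = from (∃!Factorisation⇔∃!LeftFactor u) ∘ ∃!LeftFactor u

            ∈U⇒∈Prod : ∀ x → x ∈ U → _∈Prod_,_ G x S T
            ∈U⇒∈Prod x x∈U =
              let s , lf , _ = ∃!LeftFactor x x∈U in from (∈Prod⇔∃LeftFactor x) (s , lf)

            ∈Prod⇒∈U : ∀ x → _∈Prod_,_ G x S T → x ∈ U
            ∈Prod⇒∈U x x∈ST with 𝟙-isIndicatorOf U x
            ... | inj₁ (x∈U , _) = x∈U
            ... | inj₂ (_ , 𝟙≡0) = ⊥-elim (Σℤ-indicator-≡0⇒∄ (⋆-isIndicatorOf-LeftFactor x)
                                     (trans (⋆≡𝟙 x) 𝟙≡0) (to (∈Prod⇔∃LeftFactor x) x∈ST))

        fromFactorisations : (∀ x → (x ∈ U) ⇔ _∈Prod_,_ G x S T) × (∀ u → u ∈ U → ∃! _≡_ (Factorisation u))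
          → ∀ x → _⋆_ G (sumOf G S) (sumOf G T) x ≡ sumOf G U x
        fromFactorisations (U≡ST , unique) x with 𝟙-isIndicatorOf U x
        ... | inj₁ (x∈U , 𝟙≡1) =
          trans (Σℤ-indicator-∃!⇒≡1 (⋆-isIndicatorOf-LeftFactor x)
                   (to (∃!Factorisation⇔∃!LeftFactor x) (unique x x∈U)))
                (sym 𝟙≡1)
        ... | inj₂ (x∉U , 𝟙≡0) =
          trans (Σℤ-indicator-∄⇒≡0 (⋆-isIndicatorOf-LeftFactor x)
                   (x∉U ∘ from (U≡ST x) ∘ from (∈Prod⇔∃LeftFactor x)))
                (sym 𝟙≡0)

mainTheorem1 : (n : ℕ) (G : FinGroup n) (S T U : Subset n)
    → FinGroup.e G ∉ S → FinGroup.e G ∉ T → FinGroup.e G ∉ U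
    → Symmetric G S → Symmetric G T → Symmetric G U
    → let open FinGroup G
          cond1 = ∀ i j → Adj G U i j ≡ (Adj G S ⊗ Adj G T) i j
          cond2 = (∀ x → (x ∈ U) ⇔ (_∈Prod_,_ G x S T))
                  × (∀ u → u ∈ U → ∃! _≡_ (λ (p : Fin n × Fin n) → (proj₁ p ∈ S) × (proj₂ p ∈ T) × (u ≡ proj₁ p ∙ proj₂ p)))
          cond3 = ∀ x → _⋆_ G (sumOf G S) (sumOf G T) x ≡ sumOf G U x
      in (cond1 ⇔ cond2) × (cond1 ⇔ cond3)
mainTheorem1 n G S T U _ _ _ _ _ _ =
  ⋆⇔uniqueFactorisation G S T U ⇔-∘ Adj-⊗⇔⋆ G S T U , Adj-⊗⇔⋆ G S T U
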